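{- Let $s_1,s_2,s_3$ be nonnegative integers with $s_1+s_2+s_3\le n$, and suppose that $\mathcal F_1,\mathcal F_2,\mathcal F_3\subset 2^{[n]}$ are cross partition-free. Then $$\sum_{j=1}^3\sum_{i=1}^3\left(\frac{y_j^{s_i}}{\binom{n}{s_i}}+\frac{y_j^{s_{i_+}+s_{i_- }}}{\binom{n}{s_{i_+}+s_{i_- }}}\right)\ge 6.$$
   Context: Three families $\mathcal F_1,\mathcal F_2,\mathcal F_3\subset 2^{[n]}$ are cross partition-free if there is no choice of $A\in\mathcal F_1$, $B\in\mathcal F_2$, $C\in\mathcal F_3$ such that one of these three sets equals the disjoint union of the other two. For $0\le t\le n$, $y_j^t:=\binom{n}{t}-|\{F\in\mathcal F_j: |F|=t\}|$. For $i\in[3]$, $i_+=i+1$ and $i_-=i-1$ with $3_+=1$ and $1_-=3$. -}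

module Defs where

open import Data.Bool using (Bool; true; false; if_then_else_)
open import Data.Nat using (ℕ; zero; suc; _+_; _∸_; _≡ᵇ_)
open import Data.Nat.Combinatorics using (_C_)
open import Data.Integer using (+_)
open import Data.Rational using (ℚ; _/_; 0ℚ)
open import Data.Vec using (Vec; []; _∷_)
open import Data.List using (List; []; _∷_; map; _++_; length; filter)
open import Data.Fin.Subset using (Subset; _∪_; _∩_; ⊥; ∣_∣)
open import Data.Product using (_×_)
open import Data.Sum using (_⊎_)
open import Relation.Binary.PropositionalEquality using (_≡_)
open import Relation.Nullary using (¬_)

Family : ℕ → Set
Family n = Subset n → Bool

allSubsets : (n : ℕ) → List (Subset n)
allSubsets zero = [] ∷ []
allSubsets (suc n) = map (true ∷_) (allSubsets n) ++ map (false ∷_) (allSubsets n)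

DisjUnion : ∀ {n} → Subset n → Subset n → Subset n → Set
DisjUnion X Y Z = (X ≡ Y ∪ Z) × (Y ∩ Z ≡ ⊥)

CrossPartitionFree : ∀ {n} → Family n → Family n → Family n → Set
CrossPartitionFree {n} F₁ F₂ F₃ =
  ∀ (A B D : Subset n) → F₁ A ≡ true → F₂ B ≡ true → F₃ D ≡ true →
  ¬ (DisjUnion A B D ⊎ DisjUnion B A D ⊎ DisjUnion D A B)

countLevel : ∀ {n} → Family n → ℕ → ℕ
countLevel {n} F t =
  length (filter (λ X → Data.Bool.T? (F X Data.Bool.∧ (∣ X ∣ ≡ᵇ t))) (allSubsets n))

y : ∀ {n} → Family n → ℕ → ℕ
y {n} F t = (n C t) ∸ countLevel F t

-- a / d as a rational; only ever used with d > 0 (convention: a/0 = 0).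
frac : ℕ → ℕ → ℚ
frac a zero = 0ℚ
frac a (suc d) = (+ a) / suc d

ratio : ∀ {n} → Family n → ℕ → ℚ
ratio {n} F t = frac (y F t) (n C t)

module Submission where

-- Proof idea: double counting over ordered partitions.  An ordered partition (X₁, X₂, X₃, rest)
-- of [n] with |X_c| = s_c is encoded as a word over the labels {blank, c₁, c₂, c₃} (an
-- "admissible" word); put U_c = X_{c₊} ∪ X_{c₋}.
--
-- * Local inequality: for every word, the six sets X_c, U_c miss at least six of their eighteen
--   memberships in F₁, F₂, F₃.  For each triple (X_{c₊}, X_{c₋}, U_c) cross partition-freeness
--   forbids six membership patterns; a finite check over the 2^9 membership patterns turns this into
--   a numerical bound on the missing counts, and a finite check over counts in {0..3} sums to six.
-- * Equidistribution: for g ∈ {part c, rest c}, as v runs over the admissible words, the set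
--   selected by g runs over all t-subsets of [n] equally often.  The number of words selecting X is
--   built from per-coordinate operators that commute, so it depends only on |X|.  Hence
--   y^t_F / C(n,t) is the fraction of admissible words whose selected set is missing from F.
--
-- The corollary averages the local inequality over the admissible words.

open import Defs
open import Data.Bool using (Bool; true; false; T; T?; not; _∧_; _∨_)
open import Data.Bool.Properties using (T-∧; T-≡)
open import Data.Empty using () renaming (⊥ to Empty; ⊥-elim to Empty-elim)
open import Data.Fin.Subset using (Subset; ∣_∣; _∪_; _∩_; ⊥)
open import Data.Fin.Subset.Properties using (∣p∣≤n; ∪-comm; ∩-comm)
open import Data.Integer as ℤ using (+_; +≤+)
import Data.Integer.Properties as ℤ
open import Data.List using (List; []; _∷_; _++_; length; filter)
import Data.List as List
open import Data.List.Membership.Propositional using (_∈_)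
open import Data.List.Relation.Unary.Any using (here; there)
open import Data.Nat using (ℕ; zero; suc; _+_; _*_; _∸_; _≤_; _≤ᵇ_; _<ᵇ_; _≡ᵇ_; z≤n; s≤s)
open import Data.Nat.Combinatorics using (_C_; nCk+nC[k+1]≡[n+1]C[k+1])
open import Data.Nat.GeneralisedArithmetic using (fold)
open import Data.Nat.Properties
open import Algebra.Properties.CommutativeSemigroup +-commutativeSemigroup using () renaming (interchange to +-interchange; xy∙z≈y∙xz to +-left-swap)
open import Algebra.Properties.CommutativeSemigroup *-commutativeSemigroup using () renaming (x∙yz≈y∙xz to *-left-swap; x∙yz≈z∙xy to *-rotate)
open import Data.Nat.Solver using (module +-*-Solver)
open import Data.Product using (_×_; _,_; proj₁; proj₂)
open import Data.Rational using (ℚ; _/_; toℚᵘ) renaming (_+_ to _+ℚ_; _≤_ to _≤ℚ_)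
import Data.Rational.Properties as ℚ
open import Data.Rational.Unnormalised using (ℚᵘ; mkℚᵘ; *≡*; *≤*) renaming (_≃_ to _≃ᵘ_; _≤_ to _≤ᵘ_; _+_ to _+ᵘ_)
import Data.Rational.Unnormalised.Properties as ℚᵘ
open import Data.Sum using (inj₁; inj₂)
open import Data.Vec using (Vec; []; _∷_; map)
open import Function.Base using (_|>_)
open import Function.Bundles using (Equivalence)
open import Relation.Binary.PropositionalEquality
open ≡-Reasoning

ind : Bool → ℕ
ind true = 1
ind false = 0

absent : Bool → ℕ
absent b = ind (not b)

ind-∧ : ∀ a b → ind (a ∧ b) ≡ ind a * ind b
ind-∧ true b = sym (+-identityʳ (ind b))
ind-∧ false b = refl

ind-∨ : ∀ a b → a ∧ b ≡ false → ind (a ∨ b) ≡ ind a + ind b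
ind-∨ true false _ = refl
ind-∨ false b _ = refl

ind-≡ᵇ : ∀ {m n} → m ≡ n → ind (m ≡ᵇ n) ≡ 1
ind-≡ᵇ {m} refl = cong ind (Equivalence.to T-≡ (≡⇒≡ᵇ m m refl))

∑ : {A : Set} → List A → (A → ℕ) → ℕ
∑ [] f = 0
∑ (x ∷ xs) f = f x + ∑ xs f

infix 5 ∑
syntax ∑ xs (λ x → e) = ∑[ x ∈ xs ] e

module _ {A : Set} where

  ∑-cong : ∀ xs {f g : A → ℕ} → (∀ x → f x ≡ g x) → ∑ xs f ≡ ∑ xs g
  ∑-cong [] f≗g = refl
  ∑-cong (x ∷ xs) f≗g = cong₂ _+_ (f≗g x) (∑-cong xs f≗g)

  ∑-zero : (xs : List A) → ∑[ x ∈ xs ] 0 ≡ 0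
  ∑-zero [] = refl
  ∑-zero (x ∷ xs) = ∑-zero xs

  ∑-+ : ∀ xs (f g : A → ℕ) → ∑[ x ∈ xs ] (f x + g x) ≡ ∑ xs f + ∑ xs g
  ∑-+ [] f g = refl
  ∑-+ (x ∷ xs) f g = begin
    f x + g x + (∑[ x ∈ xs ] (f x + g x)) ≡⟨ cong (_+_ (f x + g x)) (∑-+ xs f g) ⟩
    f x + g x + (∑ xs f + ∑ xs g)       ≡⟨ +-interchange (f x) (g x) (∑ xs f) (∑ xs g) ⟩
    f x + ∑ xs f + (g x + ∑ xs g)       ∎

  ∑-scale : ∀ xs c (f : A → ℕ) → ∑[ x ∈ xs ] (c * f x) ≡ c * ∑ xs f
  ∑-scale [] c f = sym (*-zeroʳ c)
  ∑-scale (x ∷ xs) c f = trans (cong (_+_ (c * f x)) (∑-scale xs c f)) (sym (*-distribˡ-+ c (f x) (∑ xs f)))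

  ∑-++ : ∀ xs ys (f : A → ℕ) → ∑ (xs ++ ys) f ≡ ∑ xs f + ∑ ys f
  ∑-++ [] ys f = refl
  ∑-++ (x ∷ xs) ys f = trans (cong (_+_ (f x)) (∑-++ xs ys f)) (sym (+-assoc (f x) (∑ xs f) (∑ ys f)))

  ∑-mono : ∀ xs {f g : A → ℕ} → (∀ x → f x ≤ g x) → ∑ xs f ≤ ∑ xs g
  ∑-mono [] f≤g = ≤-refl
  ∑-mono (x ∷ xs) f≤g = +-mono-≤ (f≤g x) (∑-mono xs f≤g)

  ∑-term : ∀ {xs x} (f : A → ℕ) → x ∈ xs → f x ≤ ∑ xs f
  ∑-term {x ∷ xs} f (here refl) = m≤m+n (f x) (∑ xs f)
  ∑-term {y ∷ xs} f (there x∈xs) = ≤-trans (∑-term f x∈xs) (m≤n+m (∑ xs f) (f y))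

∑-swap : ∀ {A B : Set} xs (ys : List B) (f : A → B → ℕ) →
  ∑[ x ∈ xs ] ∑[ y ∈ ys ] f x y ≡ ∑[ y ∈ ys ] ∑[ x ∈ xs ] f x y
∑-swap [] ys f = sym (∑-zero ys)
∑-swap (x ∷ xs) ys f = trans (cong (_+_ (∑ ys (f x))) (∑-swap xs ys f))
                             (sym (∑-+ ys (f x) (λ y → ∑[ x ∈ xs ] f x y)))

∑-map : ∀ {A B : Set} (h : A → B) xs (f : B → ℕ) → ∑ (List.map h xs) f ≡ ∑[ x ∈ xs ] f (h x)
∑-map h [] f = refl
∑-map h (x ∷ xs) f = cong (_+_ (f (h x))) (∑-map h xs f)

length-filter : ∀ {A : Set} (p : A → Bool) xs →
  length (filter (λ x → T? (p x)) xs) ≡ ∑[ x ∈ xs ] ind (p x)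
length-filter p [] = refl
length-filter p (x ∷ xs) with p x
... | true = cong suc (length-filter p xs)
... | false = length-filter p xs

∑ˢ : (n : ℕ) → (Subset n → ℕ) → ℕ
∑ˢ n h = ∑ (allSubsets n) h

∑ˢ-suc : ∀ n (h : Subset (suc n) → ℕ) →
  ∑ˢ (suc n) h ≡ ∑ˢ n (λ X → h (true ∷ X)) + ∑ˢ n (λ X → h (false ∷ X))
∑ˢ-suc n h = begin
  ∑ (List.map (true ∷_) subsets ++ List.map (false ∷_) subsets) h
    ≡⟨ ∑-++ (List.map (true ∷_) subsets) _ h ⟩
  ∑ (List.map (true ∷_) subsets) h + ∑ (List.map (false ∷_) subsets) h
    ≡⟨ cong₂ _+_ (∑-map (true ∷_) subsets h) (∑-map (false ∷_) subsets h) ⟩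
  ∑ˢ n (λ X → h (true ∷ X)) + ∑ˢ n (λ X → h (false ∷ X)) ∎
  where
  subsets : List (Subset n)
  subsets = allSubsets n

_=ᵇ_ : Bool → Bool → Bool
true =ᵇ b = b
false =ᵇ b = not b

_≟ˢ_ : ∀ {n} → Subset n → Subset n → Bool
[] ≟ˢ [] = true
(a ∷ X) ≟ˢ (b ∷ Y) = (a =ᵇ b) ∧ (X ≟ˢ Y)

∑ˢ-point : ∀ n (Y : Subset n) (h : Subset n → ℕ) → ∑ˢ n (λ X → ind (Y ≟ˢ X) * h X) ≡ h Y
∑ˢ-point zero [] h = trans (+-identityʳ (h [] + 0)) (+-identityʳ (h []))
∑ˢ-point (suc n) (true ∷ Y) h = begin
  ∑ˢ (suc n) (λ X → ind ((true ∷ Y) ≟ˢ X) * h X) ≡⟨ ∑ˢ-suc n _ ⟩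
  _ + ∑ˢ n (λ X → 0)                             ≡⟨ cong₂ _+_ (∑ˢ-point n Y (λ X → h (true ∷ X))) (∑-zero (allSubsets n)) ⟩
  h (true ∷ Y) + 0                                 ≡⟨ +-identityʳ _ ⟩
  h (true ∷ Y)                                     ∎
∑ˢ-point (suc n) (false ∷ Y) h = begin
  ∑ˢ (suc n) (λ X → ind ((false ∷ Y) ≟ˢ X) * h X) ≡⟨ ∑ˢ-suc n _ ⟩
  ∑ˢ n (λ X → 0) + _                               ≡⟨ cong₂ _+_ (∑-zero (allSubsets n)) (∑ˢ-point n Y (λ X → h (false ∷ X))) ⟩
  h (false ∷ Y)                                     ∎

∑ˢ-level : ∀ n t → ∑ˢ n (λ X → ind (∣ X ∣ ≡ᵇ t)) ≡ n C t
∑ˢ-level zero zero = refl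
∑ˢ-level zero (suc t) = refl
∑ˢ-level (suc n) zero = trans (∑ˢ-suc n _) (cong₂ _+_ (∑-zero (allSubsets n)) (∑ˢ-level n zero))
∑ˢ-level (suc n) (suc t) = begin
  ∑ˢ (suc n) (λ X → ind (∣ X ∣ ≡ᵇ suc t)) ≡⟨ ∑ˢ-suc n _ ⟩
  ∑ˢ n (λ X → ind (∣ X ∣ ≡ᵇ t)) + ∑ˢ n (λ X → ind (∣ X ∣ ≡ᵇ suc t)) ≡⟨ cong₂ _+_ (∑ˢ-level n t) (∑ˢ-level n (suc t)) ⟩
  n C t + n C suc t ≡⟨ nCk+nC[k+1]≡[n+1]C[k+1] n t ⟩
  suc n C suc t ∎

y-as-sum : ∀ n (F : Family n) t → y F t ≡ ∑ˢ n (λ X → ind (∣ X ∣ ≡ᵇ t) * absent (F X))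
y-as-sum n F t = begin
  n C t ∸ countLevel F t ≡⟨ cong₂ _∸_ (sym (∑ˢ-level n t)) (length-filter (λ X → F X ∧ (∣ X ∣ ≡ᵇ t)) (allSubsets n)) ⟩
  ∑ˢ n (λ X → ind (∣ X ∣ ≡ᵇ t)) ∸ present
    ≡⟨ cong (_∸ present) (trans (∑-cong (allSubsets n) split) (∑-+ (allSubsets n) _ _)) ⟩
  present + missing ∸ present ≡⟨ m+n∸m≡n present missing ⟩
  missing ∎
  where
  present missing : ℕ
  present = ∑ˢ n (λ X → ind (F X ∧ (∣ X ∣ ≡ᵇ t)))
  missing = ∑ˢ n (λ X → ind (∣ X ∣ ≡ᵇ t) * absent (F X))
  split : ∀ X → ind (∣ X ∣ ≡ᵇ t) ≡ ind (F X ∧ (∣ X ∣ ≡ᵇ t)) + ind (∣ X ∣ ≡ᵇ t) * absent (F X)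
  split X with F X | ∣ X ∣ ≡ᵇ t
  ... | true | true = refl
  ... | true | false = refl
  ... | false | true = refl
  ... | false | false = refl

-- An ordered partition (X₁, X₂, X₃, rest) of [n] is encoded as a word over four labels:
-- position i carries 'mark c' when i ∈ X_c and 'blank' when i lies in none of the parts.
data Colour : Set where
  c₁ c₂ c₃ : Colour

next prev : Colour → Colour
next c₁ = c₂
next c₂ = c₃
next c₃ = c₁
prev c₁ = c₃
prev c₂ = c₁
prev c₃ = c₂

∑ᶜ : (Colour → ℕ) → ℕ
∑ᶜ f = f c₁ + f c₂ + f c₃

∑ᶜ-cong : ∀ {f g : Colour → ℕ} → (∀ c → f c ≡ g c) → ∑ᶜ f ≡ ∑ᶜ g
∑ᶜ-cong f≗g = cong₂ _+_ (cong₂ _+_ (f≗g c₁) (f≗g c₂)) (f≗g c₃)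

∑ᶜ-+ : ∀ (f g : Colour → ℕ) → ∑ᶜ (λ c → f c + g c) ≡ ∑ᶜ f + ∑ᶜ g
∑ᶜ-+ f g = begin
  f c₁ + g c₁ + (f c₂ + g c₂) + (f c₃ + g c₃)
    ≡⟨ cong (_+ (f c₃ + g c₃)) (+-interchange (f c₁) (g c₁) (f c₂) (g c₂)) ⟩
  f c₁ + f c₂ + (g c₁ + g c₂) + (f c₃ + g c₃)
    ≡⟨ +-interchange (f c₁ + f c₂) (g c₁ + g c₂) (f c₃) (g c₃) ⟩
  ∑ᶜ f + ∑ᶜ g ∎

∑ᶜ-swap : ∀ (f : Colour → Colour → ℕ) → ∑ᶜ (λ c → ∑ᶜ (f c)) ≡ ∑ᶜ (λ c' → ∑ᶜ (λ c → f c c'))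
∑ᶜ-swap f = trans (∑ᶜ-+ (λ c → f c c₁ + f c c₂) (λ c → f c c₃))
                  (cong (_+ ∑ᶜ (λ c → f c c₃)) (∑ᶜ-+ (λ c → f c c₁) (λ c → f c c₂)))

data Label : Set where
  blank : Label
  mark : Colour → Label

labels : List Label
labels = blank ∷ mark c₁ ∷ mark c₂ ∷ mark c₃ ∷ []

labels-complete : ∀ l → l ∈ labels
labels-complete blank = here refl
labels-complete (mark c₁) = there (here refl)
labels-complete (mark c₂) = there (there (here refl))
labels-complete (mark c₃) = there (there (there (here refl)))

Word : ℕ → Set
Word n = Vec Label n

part : Colour → Label → Bool
part c blank = false
part c₁ (mark c₁) = true
part c₂ (mark c₂) = true
part c₃ (mark c₃) = true
part _ (mark _) = false

rest : Colour → Label → Bool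
rest c l = part (next c) l ∨ part (prev c) l

parts-disjoint : ∀ c l → part (next c) l ∧ part (prev c) l ≡ false
parts-disjoint c blank = refl
parts-disjoint c₁ (mark c₁) = refl
parts-disjoint c₁ (mark c₂) = refl
parts-disjoint c₁ (mark c₃) = refl
parts-disjoint c₂ (mark c₁) = refl
parts-disjoint c₂ (mark c₂) = refl
parts-disjoint c₂ (mark c₃) = refl
parts-disjoint c₃ (mark c₁) = refl
parts-disjoint c₃ (mark c₂) = refl
parts-disjoint c₃ (mark c₃) = refl

map-∪ : ∀ (f g : Label → Bool) {n} (v : Word n) → map (λ l → f l ∨ g l) v ≡ map f v ∪ map g v
map-∪ f g [] = refl
map-∪ f g (l ∷ v) = cong (_ ∷_) (map-∪ f g v)

map-∩ : ∀ (f g : Label → Bool) {n} (v : Word n) → (∀ l → f l ∧ g l ≡ false) → map f v ∩ map g v ≡ ⊥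
map-∩ f g [] disj = refl
map-∩ f g (l ∷ v) disj = cong₂ _∷_ (disj l) (map-∩ f g v disj)

∑ᵂ : (n : ℕ) → (Word n → ℕ) → ℕ
∑ᵂ zero f = f []
∑ᵂ (suc n) f = ∑[ l ∈ labels ] ∑ᵂ n (λ v → f (l ∷ v))

∑ᵂ-cong : ∀ n {f g : Word n → ℕ} → (∀ v → f v ≡ g v) → ∑ᵂ n f ≡ ∑ᵂ n g
∑ᵂ-cong zero f≗g = f≗g []
∑ᵂ-cong (suc n) f≗g = ∑-cong labels (λ l → ∑ᵂ-cong n (λ v → f≗g (l ∷ v)))

∑ᵂ-+ : ∀ n (f g : Word n → ℕ) → ∑ᵂ n (λ v → f v + g v) ≡ ∑ᵂ n f + ∑ᵂ n g
∑ᵂ-+ zero f g = refl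
∑ᵂ-+ (suc n) f g = trans (∑-cong labels (λ l → ∑ᵂ-+ n (λ v → f (l ∷ v)) (λ v → g (l ∷ v))))
                         (∑-+ labels (λ l → ∑ᵂ n (λ v → f (l ∷ v))) (λ l → ∑ᵂ n (λ v → g (l ∷ v))))

∑ᵂ-scale : ∀ n c (f : Word n → ℕ) → ∑ᵂ n (λ v → c * f v) ≡ c * ∑ᵂ n f
∑ᵂ-scale zero c f = refl
∑ᵂ-scale (suc n) c f = trans (∑-cong labels (λ l → ∑ᵂ-scale n c (λ v → f (l ∷ v))))
                             (∑-scale labels c (λ l → ∑ᵂ n (λ v → f (l ∷ v))))

∑ᵂ-mono : ∀ n {f g : Word n → ℕ} → (∀ v → f v ≤ g v) → ∑ᵂ n f ≤ ∑ᵂ n g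
∑ᵂ-mono zero f≤g = f≤g []
∑ᵂ-mono (suc n) f≤g = ∑-mono labels (λ l → ∑ᵂ-mono n (λ v → f≤g (l ∷ v)))

∑ᵂ-term : ∀ n (f : Word n → ℕ) v → f v ≤ ∑ᵂ n f
∑ᵂ-term zero f [] = ≤-refl
∑ᵂ-term (suc n) f (l ∷ v) =
  ≤-trans (∑ᵂ-term n (λ u → f (l ∷ u)) v) (∑-term (λ l → ∑ᵂ n (λ u → f (l ∷ u))) (labels-complete l))

∑ᵂ-swap : ∀ {A : Set} n (xs : List A) (f : Word n → A → ℕ) →
  ∑ᵂ n (λ v → ∑[ x ∈ xs ] f v x) ≡ ∑[ x ∈ xs ] ∑ᵂ n (λ v → f v x)
∑ᵂ-swap zero xs f = refl
∑ᵂ-swap (suc n) xs f = trans (∑-cong labels (λ l → ∑ᵂ-swap n xs (λ v → f (l ∷ v))))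
                             (∑-swap labels xs (λ l x → ∑ᵂ n (λ v → f (l ∷ v) x)))

∑ᵂ-fibres : ∀ n (g : Label → Bool) (w : Word n → ℕ) (h : Subset n → ℕ) →
  ∑ᵂ n (λ v → w v * h (map g v)) ≡ ∑ˢ n (λ X → h X * ∑ᵂ n (λ v → w v * ind (map g v ≟ˢ X)))
∑ᵂ-fibres n g w h = begin
  ∑ᵂ n (λ v → w v * h (map g v))
    ≡⟨ ∑ᵂ-cong n (λ v → cong (w v *_) (sym (∑ˢ-point n (map g v) h))) ⟩
  ∑ᵂ n (λ v → w v * ∑ˢ n (λ X → ind (map g v ≟ˢ X) * h X))
    ≡⟨ ∑ᵂ-cong n (λ v → sym (∑-scale (allSubsets n) (w v) _)) ⟩
  ∑ᵂ n (λ v → ∑ˢ n (λ X → w v * (ind (map g v ≟ˢ X) * h X)))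
    ≡⟨ ∑ᵂ-swap n (allSubsets n) _ ⟩
  ∑ˢ n (λ X → ∑ᵂ n (λ v → w v * (ind (map g v ≟ˢ X) * h X)))
    ≡⟨ ∑-cong (allSubsets n) (λ X → ∑ᵂ-cong n (λ v → *-rotate (w v) (ind (map g v ≟ˢ X)) (h X))) ⟩
  ∑ˢ n (λ X → ∑ᵂ n (λ v → h X * (w v * ind (map g v ≟ˢ X))))
    ≡⟨ ∑-cong (allSubsets n) (λ X → ∑ᵂ-scale n (h X) _) ⟩
  ∑ˢ n (λ X → h X * ∑ᵂ n (λ v → w v * ind (map g v ≟ˢ X))) ∎

∑ᵂ-weighted-+ : ∀ n (w f g : Word n → ℕ) →
  ∑ᵂ n (λ v → w v * (f v + g v)) ≡ ∑ᵂ n (λ v → w v * f v) + ∑ᵂ n (λ v → w v * g v)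
∑ᵂ-weighted-+ n w f g = trans (∑ᵂ-cong n (λ v → *-distribˡ-+ (w v) (f v) (g v))) (∑ᵂ-+ n (λ v → w v * f v) (λ v → w v * g v))

∑ᵂ-weighted-∑ᶜ : ∀ n (w : Word n → ℕ) (f : Colour → Word n → ℕ) →
  ∑ᵂ n (λ v → w v * ∑ᶜ (λ c → f c v)) ≡ ∑ᶜ (λ c → ∑ᵂ n (λ v → w v * f c v))
∑ᵂ-weighted-∑ᶜ n w f = trans (∑ᵂ-weighted-+ n w (λ v → f c₁ v + f c₂ v) (f c₃))
                             (cong (_+ ∑ᵂ n (λ v → w v * f c₃ v)) (∑ᵂ-weighted-+ n w (f c₁) (f c₂)))

Tally : Set
Tally = ℕ × ℕ × ℕ

start : Tally
start = 0 , 0 , 0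

count : Colour → Tally → ℕ
count c₁ (x , _ , _) = x
count c₂ (_ , y , _) = y
count c₃ (_ , _ , z) = z

tick : Label → Tally → Tally
tick blank a = a
tick (mark c₁) (x , y , z) = suc x , y , z
tick (mark c₂) (x , y , z) = x , suc y , z
tick (mark c₃) (x , y , z) = x , y , suc z

run : ∀ {n} → Tally → Word n → Tally
run a [] = a
run a (l ∷ v) = run (tick l a) v

count-tick : ∀ c l a → count c (tick l a) ≡ ind (part c l) + count c a
count-tick c blank a = refl
count-tick c₁ (mark c₁) (x , y , z) = refl
count-tick c₁ (mark c₂) (x , y , z) = refl
count-tick c₁ (mark c₃) (x , y , z) = refl
count-tick c₂ (mark c₁) (x , y , z) = refl
count-tick c₂ (mark c₂) (x , y , z) = refl
count-tick c₂ (mark c₃) (x , y , z) = refl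
count-tick c₃ (mark c₁) (x , y , z) = refl
count-tick c₃ (mark c₂) (x , y , z) = refl
count-tick c₃ (mark c₃) (x , y , z) = refl

tick-comm : ∀ l l' a → tick l (tick l' a) ≡ tick l' (tick l a)
tick-comm blank l' a = refl
tick-comm (mark c) blank a = refl
tick-comm (mark c₁) (mark c₁) (x , y , z) = refl
tick-comm (mark c₁) (mark c₂) (x , y , z) = refl
tick-comm (mark c₁) (mark c₃) (x , y , z) = refl
tick-comm (mark c₂) (mark c₁) (x , y , z) = refl
tick-comm (mark c₂) (mark c₂) (x , y , z) = refl
tick-comm (mark c₂) (mark c₃) (x , y , z) = refl
tick-comm (mark c₃) (mark c₁) (x , y , z) = refl
tick-comm (mark c₃) (mark c₂) (x , y , z) = refl
tick-comm (mark c₃) (mark c₃) (x , y , z) = refl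

size-∷ : ∀ {n} b (X : Subset n) → ∣ b ∷ X ∣ ≡ ind b + ∣ X ∣
size-∷ true X = refl
size-∷ false X = refl

record Statistic (g : Label → Bool) : Set where
  field
    stat : Tally → ℕ
    stat-start : stat start ≡ 0
    stat-tick : ∀ l a → stat (tick l a) ≡ ind (g l) + stat a

  stat-run : ∀ {n} a (v : Word n) → ∣ map g v ∣ + stat a ≡ stat (run a v)
  stat-run a [] = refl
  stat-run a (l ∷ v) = begin
    ∣ g l ∷ map g v ∣ + stat a         ≡⟨ cong (_+ stat a) (size-∷ (g l) (map g v)) ⟩
    ind (g l) + ∣ map g v ∣ + stat a   ≡⟨ +-left-swap (ind (g l)) ∣ map g v ∣ (stat a) ⟩
    ∣ map g v ∣ + (ind (g l) + stat a) ≡⟨ cong (_+_ ∣ map g v ∣) (sym (stat-tick l a)) ⟩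
    ∣ map g v ∣ + stat (tick l a)      ≡⟨ stat-run (tick l a) v ⟩
    stat (run (tick l a) v)            ∎

  stat-size : ∀ {n} (v : Word n) → ∣ map g v ∣ ≡ stat (run start v)
  stat-size v = trans (sym (trans (cong (_+_ ∣ map g v ∣) stat-start) (+-identityʳ _))) (stat-run start v)

partStatistic : ∀ c → Statistic (part c)
partStatistic c = record { stat = count c ; stat-start = count-start c ; stat-tick = count-tick c }
  where
  count-start : ∀ c → count c start ≡ 0
  count-start c₁ = refl
  count-start c₂ = refl
  count-start c₃ = refl

restStatistic : ∀ c → Statistic (rest c)
restStatistic c = record
  { stat = λ a → count (next c) a + count (prev c) a
  ; stat-start = cong₂ _+_ (Statistic.stat-start (partStatistic (next c))) (Statistic.stat-start (partStatistic (prev c)))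
  ; stat-tick = rest-tick
  }
  where
  rest-tick : ∀ l a → count (next c) (tick l a) + count (prev c) (tick l a)
                      ≡ ind (rest c l) + (count (next c) a + count (prev c) a)
  rest-tick l a = begin
    count (next c) (tick l a) + count (prev c) (tick l a)
      ≡⟨ cong₂ _+_ (count-tick (next c) l a) (count-tick (prev c) l a) ⟩
    ind (part (next c) l) + count (next c) a + (ind (part (prev c) l) + count (prev c) a)
      ≡⟨ +-interchange (ind (part (next c) l)) _ _ _ ⟩
    ind (part (next c) l) + ind (part (prev c) l) + (count (next c) a + count (prev c) a)
      ≡⟨ cong (_+ (count (next c) a + count (prev c) a)) (sym (ind-∨ (part (next c) l) (part (prev c) l) (parts-disjoint c l))) ⟩
    ind (rest c l) + (count (next c) a + count (prev c) a) ∎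

module Counting (s₁ s₂ s₃ : ℕ) where

  target : Tally
  target = s₁ , s₂ , s₃

  complete : Tally → Bool
  complete a = (count c₁ a ≡ᵇ s₁) ∧ ((count c₂ a ≡ᵇ s₂) ∧ (count c₃ a ≡ᵇ s₃))

  complete-target : ∀ a → T (complete a) → a ≡ target
  complete-target (x , y , z) ok with Equivalence.to T-∧ ok
  ... | x≡s₁ , rest with Equivalence.to T-∧ rest
  ... | y≡s₂ , z≡s₃ = cong₂ _,_ (≡ᵇ⇒≡ x s₁ x≡s₁) (cong₂ _,_ (≡ᵇ⇒≡ y s₂ y≡s₂) (≡ᵇ⇒≡ z s₃ z≡s₃))

  base : Tally → ℕ
  base a = ind (complete a)

  accepts : ∀ {n} → Tally → Word n → Bool
  accepts a v = complete (run a v)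

  admissible : ∀ {n} → Word n → ℕ
  admissible v = ind (accepts start v)

  target-complete : T (complete target)
  target-complete = Equivalence.from T-∧ (≡⇒≡ᵇ s₁ s₁ refl , Equivalence.from T-∧ (≡⇒≡ᵇ s₂ s₂ refl , ≡⇒≡ᵇ s₃ s₃ refl))

  canonical : ∀ n → ℕ → ℕ → ℕ → Word n
  canonical zero _ _ _ = []
  canonical (suc n) (suc k₁) k₂ k₃ = mark c₁ ∷ canonical n k₁ k₂ k₃
  canonical (suc n) zero (suc k₂) k₃ = mark c₂ ∷ canonical n zero k₂ k₃
  canonical (suc n) zero zero (suc k₃) = mark c₃ ∷ canonical n zero zero k₃
  canonical (suc n) zero zero zero = blank ∷ canonical n zero zero zero

  run-canonical : ∀ n k₁ k₂ k₃ x y z → k₁ + k₂ + k₃ ≤ n →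
    run (x , y , z) (canonical n k₁ k₂ k₃) ≡ (x + k₁ , y + k₂ , z + k₃)
  run-canonical zero zero zero zero x y z _ = sym (cong₂ _,_ (+-identityʳ x) (cong₂ _,_ (+-identityʳ y) (+-identityʳ z)))
  run-canonical (suc n) (suc k₁) k₂ k₃ x y z (s≤s k≤n) =
    trans (run-canonical n k₁ k₂ k₃ (suc x) y z k≤n) (cong (_, y + k₂ , z + k₃) (sym (+-suc x k₁)))
  run-canonical (suc n) zero (suc k₂) k₃ x y z (s≤s k≤n) =
    trans (run-canonical n zero k₂ k₃ x (suc y) z k≤n) (cong (λ y' → x + zero , y' , z + k₃) (sym (+-suc y k₂)))
  run-canonical (suc n) zero zero (suc k₃) x y z (s≤s k≤n) =
    trans (run-canonical n zero zero k₃ x y (suc z) k≤n) (cong (λ z' → x + zero , y + zero , z') (sym (+-suc z k₃)))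
  run-canonical (suc n) zero zero zero x y z _ = run-canonical n zero zero zero x y z z≤n

  admissible-exists : ∀ n → s₁ + s₂ + s₃ ≤ n → 1 ≤ ∑ᵂ n admissible
  admissible-exists n s≤n = subst (_≤ ∑ᵂ n admissible) canonical-admissible (∑ᵂ-term n admissible (canonical n s₁ s₂ s₃))
    where
    canonical-admissible : admissible (canonical n s₁ s₂ s₃) ≡ 1
    canonical-admissible = trans (cong base (run-canonical n s₁ s₂ s₃ 0 0 0 s≤n))
                                 (cong ind (Equivalence.to T-≡ target-complete))

  module FibresOf (g : Label → Bool) where

    -- Extend a count of words by one leading position whose label g sends to b.
    Op : Bool → (Tally → ℕ) → Tally → ℕ
    Op b φ a = ∑[ l ∈ labels ] ind (g l =ᵇ b) * φ (tick l a)

    Op-cong : ∀ b {φ ψ : Tally → ℕ} → (∀ a → φ a ≡ ψ a) → ∀ a → Op b φ a ≡ Op b ψ a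
    Op-cong b φ≗ψ a = ∑-cong labels (λ l → cong (ind (g l =ᵇ b) *_) (φ≗ψ (tick l a)))

    -- Since tallies ignore the order of labels, the extension operators commute.
    Op-comm : ∀ b b' φ a → Op b (Op b' φ) a ≡ Op b' (Op b φ) a
    Op-comm b b' φ a = begin
      ∑[ l ∈ labels ] ι b l * (∑[ l' ∈ labels ] ι b' l' * φ (tick l' (tick l a)))
        ≡⟨ ∑-cong labels (λ l → sym (∑-scale labels (ι b l) (λ l' → ι b' l' * φ (tick l' (tick l a))))) ⟩
      ∑[ l ∈ labels ] (∑[ l' ∈ labels ] ι b l * (ι b' l' * φ (tick l' (tick l a))))
        ≡⟨ ∑-swap labels labels (λ l l' → ι b l * (ι b' l' * φ (tick l' (tick l a)))) ⟩
      ∑[ l' ∈ labels ] (∑[ l ∈ labels ] ι b l * (ι b' l' * φ (tick l' (tick l a))))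
        ≡⟨ ∑-cong labels (λ l' → ∑-cong labels (λ l → reorder l l')) ⟩
      ∑[ l' ∈ labels ] (∑[ l ∈ labels ] ι b' l' * (ι b l * φ (tick l (tick l' a))))
        ≡⟨ ∑-cong labels (λ l' → ∑-scale labels (ι b' l') (λ l → ι b l * φ (tick l (tick l' a)))) ⟩
      ∑[ l' ∈ labels ] ι b' l' * (∑[ l ∈ labels ] ι b l * φ (tick l (tick l' a))) ∎
      where
      ι : Bool → Label → ℕ
      ι b l = ind (g l =ᵇ b)
      reorder : ∀ l l' → ι b l * (ι b' l' * φ (tick l' (tick l a))) ≡ ι b' l' * (ι b l * φ (tick l (tick l' a)))
      reorder l l' = trans (*-left-swap (ι b l) (ι b' l') _)
                           (cong (λ x → ι b' l' * (ι b l * φ x)) (tick-comm l' l a))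

    layers : ℕ → ℕ → (Tally → ℕ) → Tally → ℕ
    layers t u φ = fold (fold φ (Op false) u) (Op true) t

    Op-false-layers : ∀ t u φ a → Op false (layers t u φ) a ≡ layers t (suc u) φ a
    Op-false-layers zero u φ a = refl
    Op-false-layers (suc t) u φ a =
      trans (Op-comm false true (layers t u φ) a) (Op-cong true (Op-false-layers t u φ) a)

    fibre : ∀ {n} → Subset n → Tally → ℕ
    fibre {n} X a = ∑ᵂ n (λ v → ind (accepts a v) * ind (map g v ≟ˢ X))

    fibre-∷ : ∀ {n} b (X : Subset n) a → fibre (b ∷ X) a ≡ Op b (fibre X) a
    fibre-∷ {n} b X a = ∑-cong labels (λ l → begin
      ∑ᵂ n (λ v → ind (accepts (tick l a) v) * ind ((g l =ᵇ b) ∧ (map g v ≟ˢ X)))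
        ≡⟨ ∑ᵂ-cong n (λ v → cong (ind (accepts (tick l a) v) *_) (ind-∧ (g l =ᵇ b) (map g v ≟ˢ X))) ⟩
      ∑ᵂ n (λ v → ind (accepts (tick l a) v) * (ind (g l =ᵇ b) * ind (map g v ≟ˢ X)))
        ≡⟨ ∑ᵂ-cong n (λ v → *-left-swap (ind (accepts (tick l a) v)) (ind (g l =ᵇ b)) _) ⟩
      ∑ᵂ n (λ v → ind (g l =ᵇ b) * (ind (accepts (tick l a) v) * ind (map g v ≟ˢ X)))
        ≡⟨ ∑ᵂ-scale n (ind (g l =ᵇ b)) _ ⟩
      ind (g l =ᵇ b) * fibre X (tick l a) ∎)

    -- Key symmetry: the fibre over X depends only on |X|, since the operators building it commute.
    fibre-layers : ∀ {n} (X : Subset n) a → fibre X a ≡ layers ∣ X ∣ (n ∸ ∣ X ∣) base a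
    fibre-layers [] a = *-identityʳ (ind (complete a))
    fibre-layers (true ∷ X) a = trans (fibre-∷ true X a) (Op-cong true (fibre-layers X) a)
    fibre-layers {suc n} (false ∷ X) a = begin
      fibre (false ∷ X) a
        ≡⟨ trans (fibre-∷ false X a) (Op-cong false (fibre-layers X) a) ⟩
      Op false (layers k (n ∸ k) base) a
        ≡⟨ Op-false-layers k (n ∸ k) base a ⟩
      layers k (suc (n ∸ k)) base a
        ≡⟨ cong (λ u → layers k u base a) (sym (+-∸-assoc 1 (∣p∣≤n X))) ⟩
      layers k (suc n ∸ k) base a ∎
      where
      k : ℕ
      k = ∣ X ∣

    module Equidistribution (σ : Statistic g) where
      open Statistic σ

      t : ℕ
      t = stat target

      multiplicity : ℕ → ℕ
      multiplicity n = layers t (n ∸ t) base start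

      admissible-size : ∀ {n} (v : Word n) → T (accepts start v) → ∣ map g v ∣ ≡ t
      admissible-size v ok = trans (stat-size v) (cong stat (complete-target _ ok))

      equidistribution : ∀ n (h : Subset n → ℕ) →
        ∑ᵂ n (λ v → admissible v * h (map g v)) ≡ multiplicity n * ∑ˢ n (λ X → ind (∣ X ∣ ≡ᵇ t) * h X)
      equidistribution n h = begin
        ∑ᵂ n (λ v → admissible v * h (map g v))  ≡⟨ ∑ᵂ-cong n restrict ⟩
        ∑ᵂ n (λ v → admissible v * h′ (map g v)) ≡⟨ ∑ᵂ-fibres n g admissible h′ ⟩
        ∑ˢ n (λ X → h′ X * fibre X start)          ≡⟨ ∑-cong (allSubsets n) uniform ⟩
        ∑ˢ n (λ X → multiplicity n * h′ X)         ≡⟨ ∑-scale (allSubsets n) (multiplicity n) h′ ⟩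
        multiplicity n * ∑ˢ n h′                   ∎
        where
        h′ : Subset n → ℕ
        h′ X = ind (∣ X ∣ ≡ᵇ t) * h X
        restrict : ∀ v → admissible v * h (map g v) ≡ admissible v * h′ (map g v)
        restrict v with accepts start v in ok
        ... | false = refl
        ... | true = cong (1 *_) (sym (trans (cong (_* h (map g v)) (ind-≡ᵇ (admissible-size v (Equivalence.from T-≡ ok))))
                                             (*-identityˡ (h (map g v)))))
        uniform : ∀ X → h′ X * fibre X start ≡ multiplicity n * h′ X
        uniform X with ∣ X ∣ ≡ᵇ t in size
        ... | false = sym (*-zeroʳ (multiplicity n))
        ... | true = trans (cong (1 * h X *_) (trans (fibre-layers X start)
                                                      (cong (λ s → layers s (n ∸ s) base start)
                                                            (≡ᵇ⇒≡ ∣ X ∣ t (Equivalence.from T-≡ size)))))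
                           (*-comm (1 * h X) (multiplicity n))

Formula : Set → ℕ → Set
Formula A zero = Bool
Formula A (suc k) = A → Formula A k

Tautology : ∀ k → Formula Bool k → Set
Tautology zero φ = T φ
Tautology (suc k) φ = ∀ b → Tautology k (φ b)

tautology? : ∀ k → Formula Bool k → Bool
tautology? zero φ = φ
tautology? (suc k) φ = tautology? k (φ true) ∧ tautology? k (φ false)

tautology-sound : ∀ k φ → T (tautology? k φ) → Tautology k φ
tautology-sound zero φ holds = holds
tautology-sound (suc k) φ holds true = tautology-sound k (φ true) (proj₁ (Equivalence.to T-∧ holds))
tautology-sound (suc k) φ holds false = tautology-sound k (φ false) (proj₂ (Equivalence.to T-∧ holds))

HoldsUpTo : ℕ → ∀ k → Formula ℕ k → Set
HoldsUpTo b zero φ = T φ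
HoldsUpTo b (suc k) φ = ∀ x → x ≤ b → HoldsUpTo b k (φ x)

allUpTo : ℕ → (ℕ → Bool) → Bool
allUpTo zero p = p 0
allUpTo (suc b) p = allUpTo b p ∧ p (suc b)

allUpTo-sound : ∀ b p → T (allUpTo b p) → ∀ x → x ≤ b → T (p x)
allUpTo-sound zero p holds zero z≤n = holds
allUpTo-sound (suc b) p holds x x≤b+1 with m≤n⇒m<n∨m≡n x≤b+1
... | inj₁ (s≤s x≤b) = allUpTo-sound b p (proj₁ (Equivalence.to T-∧ holds)) x x≤b
... | inj₂ refl = proj₂ (Equivalence.to T-∧ holds)

holdsUpTo? : ℕ → ∀ k → Formula ℕ k → Bool
holdsUpTo? b zero φ = φ
holdsUpTo? b (suc k) φ = allUpTo b (λ x → holdsUpTo? b k (φ x))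

holdsUpTo-sound : ∀ b k φ → T (holdsUpTo? b k φ) → HoldsUpTo b k φ
holdsUpTo-sound b zero φ holds = holds
holdsUpTo-sound b (suc k) φ holds x x≤b =
  holdsUpTo-sound b k (φ x) (allUpTo-sound b (λ x → holdsUpTo? b k (φ x)) holds x x≤b)

_⇒ᵇ_ : Bool → Bool → Bool
a ⇒ᵇ b = not a ∨ b

⇒ᵇ-elim : ∀ {a b} → T (a ⇒ᵇ b) → T a → T b
⇒ᵇ-elim {true} holds _ = holds

infixr 1 ⟨_,_,_⟩∨_
⟨_,_,_⟩∨_ : Bool → Bool → Bool → Bool → Bool
⟨ a , b , c ⟩∨ φ = (a ∧ b ∧ c) ∨ φ

discharge : ∀ {a b c φ} → (a ≡ true → b ≡ true → c ≡ true → Empty) → T (⟨ a , b , c ⟩∨ φ) → T φ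
discharge {true} {true} {true} excluded _ = Empty-elim (excluded refl refl refl)
discharge {true} {true} {false} _ holds = holds
discharge {true} {false} _ holds = holds
discharge {false} _ holds = holds

missing₃ : Bool → Bool → Bool → ℕ
missing₃ a b c = absent a + absent b + absent c

missing₃≤3 : ∀ a b c → missing₃ a b c ≤ 3
missing₃≤3 a b c = +-mono-≤ (+-mono-≤ (absent≤1 a) (absent≤1 b)) (absent≤1 c)
  where
  absent≤1 : ∀ a → absent a ≤ 1
  absent≤1 true = z≤n
  absent≤1 false = s≤s z≤n

-- What cross partition-freeness says about P, Q and R = P ⊔ Q in terms of x, y, u, the numbers
-- of families missing P, Q and R: at least three memberships fail, and if R lies in all three
-- families then P and Q cannot meet two different families (one lies in none, or both in at most one).
tripleBound : ℕ → ℕ → ℕ → Bool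
tripleBound x y u = (3 ≤ᵇ x + y + u) ∧ ((0 <ᵇ u) ∨ ((2 ≤ᵇ x) ∧ (2 ≤ᵇ y)) ∨ (x ≡ᵇ 3) ∨ (y ≡ᵇ 3))

-- Memberships p_j, q_j, r_j of P, Q, R in F_j: unless one of the six partition patterns
-- (R ∈ F_a, P ∈ F_b, Q ∈ F_c with {a, b, c} = {1, 2, 3}) occurs, tripleBound holds.
triple-formula : Formula Bool 9
triple-formula p₁ p₂ p₃ q₁ q₂ q₃ r₁ r₂ r₃ =
  ⟨ r₁ , p₂ , q₃ ⟩∨ ⟨ r₁ , q₂ , p₃ ⟩∨ ⟨ p₁ , r₂ , q₃ ⟩∨ ⟨ q₁ , r₂ , p₃ ⟩∨ ⟨ p₁ , q₂ , r₃ ⟩∨ ⟨ q₁ , p₂ , r₃ ⟩∨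
  tripleBound (missing₃ p₁ p₂ p₃) (missing₃ q₁ q₂ q₃) (missing₃ r₁ r₂ r₃)

triple-tautology : Tautology 9 triple-formula
triple-tautology = tautology-sound 9 triple-formula _

six-formula : Formula ℕ 6
six-formula x₁ x₂ x₃ u₁ u₂ u₃ =
  (tripleBound x₂ x₃ u₁ ∧ tripleBound x₃ x₁ u₂ ∧ tripleBound x₁ x₂ u₃) ⇒ᵇ (6 ≤ᵇ x₁ + x₂ + x₃ + (u₁ + u₂ + u₃))

six-lemma : HoldsUpTo 3 6 six-formula
six-lemma = holdsUpTo-sound 3 6 six-formula _

module CrossPartitionFreeness {n} (F₁ F₂ F₃ : Family n) (cpf : CrossPartitionFree F₁ F₂ F₃) where

  family : Colour → Family n
  family c₁ = F₁
  family c₂ = F₂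
  family c₃ = F₃

  missing : Subset n → ℕ
  missing S = ∑ᶜ (λ j → absent (family j S))

  triple-bound : ∀ P Q → P ∩ Q ≡ ⊥ → T (tripleBound (missing P) (missing Q) (missing (P ∪ Q)))
  triple-bound P Q disjoint =
    triple-tautology (F₁ P) (F₂ P) (F₃ P) (F₁ Q) (F₂ Q) (F₃ Q) (F₁ R) (F₂ R) (F₃ R)
      |> discharge (λ r p q → cpf R P Q r p q (inj₁ split))
      |> discharge (λ r q p → cpf R Q P r q p (inj₁ split′))
      |> discharge (λ p r q → cpf P R Q p r q (inj₂ (inj₁ split)))
      |> discharge (λ q r p → cpf Q R P q r p (inj₂ (inj₁ split′)))
      |> discharge (λ p q r → cpf P Q R p q r (inj₂ (inj₂ split)))
      |> discharge (λ q p r → cpf Q P R q p r (inj₂ (inj₂ split′)))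
    where
    R : Subset n
    R = P ∪ Q
    split : DisjUnion R P Q
    split = refl , disjoint
    split′ : DisjUnion R Q P
    split′ = ∪-comm P Q , trans (∩-comm Q P) disjoint

  missingAt : Family n → Word n → ℕ
  missingAt F v = ∑ᶜ (λ c → absent (F (map (part c) v)) + absent (F (map (rest c) v)))

  local-bound : ∀ v → 6 ≤ ∑ᶜ (λ j → missingAt (family j) v)
  local-bound v = subst (6 ≤_) (sym regroup)
    (≤ᵇ⇒≤ 6 _ (⇒ᵇ-elim (six-lemma (x c₁) (≤3 (X c₁)) (x c₂) (≤3 (X c₂)) (x c₃) (≤3 (X c₃))
                                   (u c₁) (≤3 (U c₁)) (u c₂) (≤3 (U c₂)) (u c₃) (≤3 (U c₃)))
                        (Equivalence.from T-∧ (bound c₁ , Equivalence.from T-∧ (bound c₂ , bound c₃)))))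
    where
    X U : Colour → Subset n
    X c = map (part c) v
    U c = map (rest c) v
    x u : Colour → ℕ
    x c = missing (X c)
    u c = missing (U c)
    ≤3 : ∀ S → missing S ≤ 3
    ≤3 S = missing₃≤3 (F₁ S) (F₂ S) (F₃ S)
    bound : ∀ c → T (tripleBound (x (next c)) (x (prev c)) (u c))
    bound c = subst (λ S → T (tripleBound (x (next c)) (x (prev c)) (missing S)))
                    (sym (map-∪ (part (next c)) (part (prev c)) v))
                    (triple-bound (X (next c)) (X (prev c)) (map-∩ (part (next c)) (part (prev c)) v (parts-disjoint c)))
    regroup : ∑ᶜ (λ j → missingAt (family j) v) ≡ ∑ᶜ x + ∑ᶜ u
    regroup = begin
      ∑ᶜ (λ j → ∑ᶜ (λ c → absent (family j (X c)) + absent (family j (U c))))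
        ≡⟨ ∑ᶜ-cong (λ j → ∑ᶜ-+ (λ c → absent (family j (X c))) (λ c → absent (family j (U c)))) ⟩
      ∑ᶜ (λ j → ∑ᶜ (λ c → absent (family j (X c))) + ∑ᶜ (λ c → absent (family j (U c))))
        ≡⟨ ∑ᶜ-+ (λ j → ∑ᶜ (λ c → absent (family j (X c)))) (λ j → ∑ᶜ (λ c → absent (family j (U c)))) ⟩
      ∑ᶜ (λ j → ∑ᶜ (λ c → absent (family j (X c)))) + ∑ᶜ (λ j → ∑ᶜ (λ c → absent (family j (U c))))
        ≡⟨ cong₂ _+_ (∑ᶜ-swap (λ j c → absent (family j (X c)))) (∑ᶜ-swap (λ j c → absent (family j (U c)))) ⟩
      ∑ᶜ x + ∑ᶜ u ∎

module Denominator (d : ℕ) where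

  _/N : ℕ → ℚᵘ
  q /N = mkℚᵘ (+ q) d

  N : ℕ
  N = suc d

  /N-+ : ∀ a b → a /N +ᵘ b /N ≃ᵘ (a + b) /N
  /N-+ a b = *≡* (begin
    (+ a ℤ.* + N ℤ.+ + b ℤ.* + N) ℤ.* + N ≡⟨ cong (ℤ._* + N) (cong₂ ℤ._+_ (sym (ℤ.pos-* a N)) (sym (ℤ.pos-* b N))) ⟩
    (+ (a * N) ℤ.+ + (b * N)) ℤ.* + N       ≡⟨ cong (ℤ._* + N) (sym (ℤ.pos-+ (a * N) (b * N))) ⟩
    + (a * N + b * N) ℤ.* + N               ≡⟨ sym (ℤ.pos-* (a * N + b * N) N) ⟩
    + ((a * N + b * N) * N)                 ≡⟨ cong +_ (common-denominator a b N) ⟩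
    + ((a + b) * (N * N))                   ≡⟨ ℤ.pos-* (a + b) (N * N) ⟩
    + (a + b) ℤ.* + (N * N)                 ∎)
    where
    common-denominator : ∀ a b N → (a * N + b * N) * N ≡ (a + b) * (N * N)
    common-denominator = solve 3 (λ a b N → (a :* N :+ b :* N) :* N := (a :+ b) :* (N :* N)) refl
      where open +-*-Solver

  toℚᵘ-+ : ∀ p q a b → toℚᵘ p ≃ᵘ a /N → toℚᵘ q ≃ᵘ b /N → toℚᵘ (p +ℚ q) ≃ᵘ (a + b) /N
  toℚᵘ-+ p q a b p≃a q≃b = ℚᵘ.≃-trans (ℚ.toℚᵘ-homo-+ p q) (ℚᵘ.≃-trans (ℚᵘ.+-cong p≃a q≃b) (/N-+ a b))

  toℚᵘ-∑ᶜ : ∀ (q : Colour → ℚ) (a : Colour → ℕ) → (∀ c → toℚᵘ (q c) ≃ᵘ a c /N) →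
    toℚᵘ (q c₁ +ℚ q c₂ +ℚ q c₃) ≃ᵘ ∑ᶜ a /N
  toℚᵘ-∑ᶜ q a q≃a = toℚᵘ-+ _ _ _ _ (toℚᵘ-+ _ _ _ _ (q≃a c₁) (q≃a c₂)) (q≃a c₃)

  frac-rescale : ∀ y C R Q → Q ≡ R * y → N ≡ R * C → toℚᵘ (frac y C) ≃ᵘ Q /N
  frac-rescale y zero R Q _ N≡R*0 with () ← trans N≡R*0 (*-zeroʳ R)
  frac-rescale y (suc c) R Q Q≡R*y N≡R*C = ℚᵘ.≃-trans (ℚ.toℚᵘ-fromℚᵘ (mkℚᵘ (+ y) c)) (*≡* (begin
    + y ℤ.* + N      ≡⟨ sym (ℤ.pos-* y N) ⟩
    + (y * N)        ≡⟨ cong +_ cross ⟩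
    + (Q * suc c)    ≡⟨ ℤ.pos-* Q (suc c) ⟩
    + Q ℤ.* + suc c  ∎))
    where
    cross : y * N ≡ Q * suc c
    cross = begin
      y * N           ≡⟨ cong (y *_) N≡R*C ⟩
      y * (R * suc c) ≡⟨ sym (*-assoc y R (suc c)) ⟩
      y * R * suc c   ≡⟨ cong (_* suc c) (trans (*-comm y R) (sym Q≡R*y)) ⟩
      Q * suc c       ∎

  six-≤ : ∀ S → 6 * N ≤ S → toℚᵘ ((+ 6) / 1) ≤ᵘ S /N
  six-≤ S 6N≤S = *≤* (subst₂ ℤ._≤_ (ℤ.pos-* 6 N) (trans (cong +_ (sym (*-identityʳ S))) (ℤ.pos-* S 1)) (+≤+ 6N≤S))

module Averaging (n s₁ s₂ s₃ : ℕ) (F₁ F₂ F₃ : Family n) (cpf : CrossPartitionFree F₁ F₂ F₃)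
                 (d : ℕ) (admissible-count : ∑ᵂ n (Counting.admissible s₁ s₂ s₃) ≡ suc d) where
  open Counting s₁ s₂ s₃
  open CrossPartitionFreeness F₁ F₂ F₃ cpf
  open Denominator d

  size : Colour → ℕ
  size c = count c target

  misses : Family n → (Label → Bool) → ℕ
  misses F g = ∑ᵂ n (λ v → admissible v * absent (F (map g v)))

  ratio-average : ∀ {g} (σ : Statistic g) F → toℚᵘ (ratio F (Statistic.stat σ target)) ≃ᵘ misses F g /N
  ratio-average {g} σ F = frac-rescale (y F t) (n C t) (multiplicity n) (misses F g) misses≡ N≡
    where
    open FibresOf g
    open Equidistribution σ
    misses≡ : misses F g ≡ multiplicity n * y F t
    misses≡ = trans (equidistribution n (λ X → absent (F X))) (cong (multiplicity n *_) (sym (y-as-sum n F t)))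
    N≡ : suc d ≡ multiplicity n * (n C t)
    N≡ = begin
      suc d                                               ≡⟨ sym admissible-count ⟩
      ∑ᵂ n admissible                                     ≡⟨ ∑ᵂ-cong n (λ v → sym (*-identityʳ (admissible v))) ⟩
      ∑ᵂ n (λ v → admissible v * 1)                       ≡⟨ equidistribution n (λ _ → 1) ⟩
      multiplicity n * ∑ˢ n (λ X → ind (∣ X ∣ ≡ᵇ t) * 1) ≡⟨ cong (multiplicity n *_) levels ⟩
      multiplicity n * (n C t)                              ∎
      where
      levels : ∑ˢ n (λ X → ind (∣ X ∣ ≡ᵇ t) * 1) ≡ n C t
      levels = trans (∑-cong (allSubsets n) (λ X → *-identityʳ (ind (∣ X ∣ ≡ᵇ t)))) (∑ˢ-level n t)

  term : Family n → Colour → ℚ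
  term F c = ratio F (size c) +ℚ ratio F (size (next c) + size (prev c))

  familyTerm : Family n → ℚ
  familyTerm F = term F c₁ +ℚ term F c₂ +ℚ term F c₃

  familyTerm-average : ∀ F → toℚᵘ (familyTerm F) ≃ᵘ ∑ᶜ (λ c → misses F (part c) + misses F (rest c)) /N
  familyTerm-average F = toℚᵘ-∑ᶜ (term F) (λ c → misses F (part c) + misses F (rest c))
    (λ c → toℚᵘ-+ _ _ _ _ (ratio-average (partStatistic c) F) (ratio-average (restStatistic c) F))

  misses-total : ∑ᶜ (λ j → ∑ᶜ (λ c → misses (family j) (part c) + misses (family j) (rest c)))
               ≡ ∑ᵂ n (λ v → admissible v * ∑ᶜ (λ j → missingAt (family j) v))
  misses-total = sym (begin
    ∑ᵂ n (λ v → admissible v * ∑ᶜ (λ j → missingAt (family j) v))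
      ≡⟨ ∑ᵂ-weighted-∑ᶜ n admissible (λ j v → missingAt (family j) v) ⟩
    ∑ᶜ (λ j → ∑ᵂ n (λ v → admissible v * ∑ᶜ (λ c → inPart j c v + inRest j c v)))
      ≡⟨ ∑ᶜ-cong (λ j → ∑ᵂ-weighted-∑ᶜ n admissible (λ c v → inPart j c v + inRest j c v)) ⟩
    ∑ᶜ (λ j → ∑ᶜ (λ c → ∑ᵂ n (λ v → admissible v * (inPart j c v + inRest j c v))))
      ≡⟨ ∑ᶜ-cong (λ j → ∑ᶜ-cong (λ c → ∑ᵂ-weighted-+ n admissible (inPart j c) (inRest j c))) ⟩
    ∑ᶜ (λ j → ∑ᶜ (λ c → misses (family j) (part c) + misses (family j) (rest c))) ∎)
    where
    inPart inRest : Colour → Colour → Word n → ℕ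
    inPart j c v = absent (family j (map (part c) v))
    inRest j c v = absent (family j (map (rest c) v))

  local-bound-summed : 6 * suc d ≤ ∑ᵂ n (λ v → admissible v * ∑ᶜ (λ j → missingAt (family j) v))
  local-bound-summed = subst (_≤ ∑ᵂ n (λ v → admissible v * ∑ᶜ (λ j → missingAt (family j) v))) six-N
                             (∑ᵂ-mono n (λ v → *-monoʳ-≤ (admissible v) (local-bound v)))
    where
    six-N : ∑ᵂ n (λ v → admissible v * 6) ≡ 6 * suc d
    six-N = trans (∑ᵂ-cong n (λ v → *-comm (admissible v) 6)) (trans (∑ᵂ-scale n 6 admissible) (cong (6 *_) admissible-count))

  main-inequality : (+ 6) / 1 ≤ℚ familyTerm F₁ +ℚ familyTerm F₂ +ℚ familyTerm F₃
  main-inequality = ℚ.toℚᵘ-cancel-≤ (ℚᵘ.≤-trans (six-≤ _ local-bound-summed) (ℚᵘ.≤-reflexive (ℚᵘ.≃-sym total)))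
    where
    total : toℚᵘ (familyTerm F₁ +ℚ familyTerm F₂ +ℚ familyTerm F₃)
            ≃ᵘ ∑ᵂ n (λ v → admissible v * ∑ᶜ (λ j → missingAt (family j) v)) /N
    total = ℚᵘ.≃-trans (toℚᵘ-∑ᶜ (λ j → familyTerm (family j)) _ (λ j → familyTerm-average (family j)))
                       (ℚᵘ.≃-reflexive (cong _/N misses-total))

corollary1 : (n s₁ s₂ s₃ : ℕ) → s₁ + s₂ + s₃ ≤ n →
    (F₁ F₂ F₃ : Family n) → CrossPartitionFree F₁ F₂ F₃ →
    let T : Family n → ℚ
        T F = (ratio F s₁ +ℚ ratio F (s₂ + s₃))
              +ℚ (ratio F s₂ +ℚ ratio F (s₃ + s₁))
              +ℚ (ratio F s₃ +ℚ ratio F (s₁ + s₂))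
    in (+ 6) / 1 ≤ℚ T F₁ +ℚ T F₂ +ℚ T F₃
corollary1 n s₁ s₂ s₃ s≤n F₁ F₂ F₃ cpf
  with ∑ᵂ n (Counting.admissible s₁ s₂ s₃) in admissible-count | Counting.admissible-exists s₁ s₂ s₃ n s≤n
... | suc d | _ = Averaging.main-inequality n s₁ s₂ s₃ F₁ F₂ F₃ cpf d admissible-count
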